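{- In a target–context category $(\mathcal{C},T,C,\succeq)$, every scalar $w\colon I\to I$ and every morphism $f\colon A\to T\otimes C$ satisfy $f\succeq w\otimes f$.
   Context: A gs-monoidal category is a symmetric monoidal category (tensor $\otimes$, unit $I$, unitors suppressed so that $w\otimes f\colon A\to T\otimes C$) whose objects carry commutative comonoids $\mathrm{copy}_A\colon A\to A\otimes A$, $\mathrm{del}_A\colon A\to I$ compatible with $\otimes$, with $\mathrm{del}_I=\mathrm{id}_I$. For $f\colon A\to X$: $\mathrm{dom}(f)=(\mathrm{id}_A\otimes(\mathrm{del}_X\circ f))\circ\mathrm{copy}_A$; normalized: $f\circ\mathrm{dom}(f)=f$. A target–context category $(\mathcal{C},T,C,\succeq)$ is a gs-monoidal category with all morphisms normalized, objects $T,C$ and a preorder $\succeq$ on each $\mathcal{C}(A,T\otimes C)$ such that $f\circ\mathrm{dom}(g)=g\Rightarrow f\succeq g$ and $f\succeq g\Rightarrow f\circ h\succeq g\circ h$. -}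

module Defs where

open import Level using (Level; _⊔_; suc)
open import Relation.Binary.PropositionalEquality using (_≡_)
open import Relation.Binary.Structures using (IsPreorder)

record SymmetricMonoidalCategory (o ℓ : Level) : Set (suc (o ⊔ ℓ)) where
  infixr 9 _∘_
  infixr 10 _⊗₀_ _⊗₁_
  field
    Obj : Set o
    Hom : Obj → Obj → Set ℓ
    id  : ∀ {A} → Hom A A
    _∘_ : ∀ {A B C} → Hom B C → Hom A B → Hom A C
    identityˡ : ∀ {A B} {f : Hom A B} → id ∘ f ≡ f
    identityʳ : ∀ {A B} {f : Hom A B} → f ∘ id ≡ f
    assoc : ∀ {A B C D} {f : Hom A B} {g : Hom B C} {h : Hom C D} →
            (h ∘ g) ∘ f ≡ h ∘ (g ∘ f)

    _⊗₀_ : Obj → Obj → Obj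
    _⊗₁_ : ∀ {A B C D} → Hom A B → Hom C D → Hom (A ⊗₀ C) (B ⊗₀ D)
    ⊗-identity : ∀ {A B} → id {A} ⊗₁ id {B} ≡ id
    ⊗-homomorphism : ∀ {A B C D E F}
      {f : Hom A B} {g : Hom B C} {h : Hom D E} {k : Hom E F} →
      (g ∘ f) ⊗₁ (k ∘ h) ≡ (g ⊗₁ k) ∘ (f ⊗₁ h)
    unit : Obj

    α⇒ : ∀ {A B C} → Hom ((A ⊗₀ B) ⊗₀ C) (A ⊗₀ (B ⊗₀ C))
    α⇐ : ∀ {A B C} → Hom (A ⊗₀ (B ⊗₀ C)) ((A ⊗₀ B) ⊗₀ C)
    α-isoˡ : ∀ {A B C} → α⇐ {A} {B} {C} ∘ α⇒ ≡ id
    α-isoʳ : ∀ {A B C} → α⇒ {A} {B} {C} ∘ α⇐ ≡ id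
    α-natural : ∀ {A B C D E F} {f : Hom A D} {g : Hom B E} {h : Hom C F} →
      α⇒ ∘ ((f ⊗₁ g) ⊗₁ h) ≡ (f ⊗₁ (g ⊗₁ h)) ∘ α⇒

    λ⇒ : ∀ {A} → Hom (unit ⊗₀ A) A
    λ⇐ : ∀ {A} → Hom A (unit ⊗₀ A)
    λ-isoˡ : ∀ {A} → λ⇐ {A} ∘ λ⇒ ≡ id
    λ-isoʳ : ∀ {A} → λ⇒ {A} ∘ λ⇐ ≡ id
    λ-natural : ∀ {A B} {f : Hom A B} → λ⇒ ∘ (id ⊗₁ f) ≡ f ∘ λ⇒

    ρ⇒ : ∀ {A} → Hom (A ⊗₀ unit) A
    ρ⇐ : ∀ {A} → Hom A (A ⊗₀ unit)
    ρ-isoˡ : ∀ {A} → ρ⇐ {A} ∘ ρ⇒ ≡ id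
    ρ-isoʳ : ∀ {A} → ρ⇒ {A} ∘ ρ⇐ ≡ id
    ρ-natural : ∀ {A B} {f : Hom A B} → ρ⇒ ∘ (f ⊗₁ id) ≡ f ∘ ρ⇒

    σ : ∀ {A B} → Hom (A ⊗₀ B) (B ⊗₀ A)
    σ-involutive : ∀ {A B} → σ {B} {A} ∘ σ {A} {B} ≡ id
    σ-natural : ∀ {A B C D} {f : Hom A C} {g : Hom B D} →
      σ ∘ (f ⊗₁ g) ≡ (g ⊗₁ f) ∘ σ

    pentagon : ∀ {A B C D} →
      (id {A} ⊗₁ α⇒ {B} {C} {D}) ∘ α⇒ ∘ (α⇒ ⊗₁ id) ≡ α⇒ ∘ α⇒
    triangle : ∀ {A B} →
      (id {A} ⊗₁ λ⇒ {B}) ∘ α⇒ ≡ ρ⇒ ⊗₁ id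
    hexagon : ∀ {A B C} →
      (id {B} ⊗₁ σ {A} {C}) ∘ α⇒ ∘ (σ ⊗₁ id) ≡ α⇒ ∘ σ ∘ α⇒

record GSMonoidalCategory (o ℓ : Level) : Set (suc (o ⊔ ℓ)) where
  field
    smc : SymmetricMonoidalCategory o ℓ
  open SymmetricMonoidalCategory smc public
  field
    copy : ∀ {A} → Hom A (A ⊗₀ A)
    del  : ∀ {A} → Hom A unit

    counitˡ : ∀ {A} → λ⇒ ∘ (del ⊗₁ id) ∘ copy {A} ≡ id
    counitʳ : ∀ {A} → ρ⇒ ∘ (id ⊗₁ del) ∘ copy {A} ≡ id
    coassoc : ∀ {A} → α⇒ ∘ (copy ⊗₁ id) ∘ copy {A} ≡ (id ⊗₁ copy) ∘ copy
    cocomm  : ∀ {A} → σ ∘ copy {A} ≡ copy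

    copy-⊗ : ∀ {A B} →
      copy {A ⊗₀ B} ≡
        α⇐ ∘ (id ⊗₁ (α⇒ ∘ (σ ⊗₁ id) ∘ α⇐)) ∘ α⇒ ∘ (copy {A} ⊗₁ copy {B})
    del-⊗  : ∀ {A B} → del {A ⊗₀ B} ≡ λ⇒ ∘ (del {A} ⊗₁ del {B})
    copy-unit : copy {unit} ≡ λ⇐
    del-unit  : del {unit} ≡ id

  -- dom(f) = (id_A ⊗ (del_X ∘ f)) ∘ copy_A   (right unitor made explicit)
  dom : ∀ {A X} → Hom A X → Hom A A
  dom f = ρ⇒ ∘ (id ⊗₁ (del ∘ f)) ∘ copy

  Normalized : ∀ {A X} → Hom A X → Set ℓ
  Normalized f = f ∘ dom f ≡ f

  -- w ⊗ f : A → X for a scalar w : I → I (left unitors made explicit)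
  scale : ∀ {A X} → Hom unit unit → Hom A X → Hom A X
  scale w f = λ⇒ ∘ (w ⊗₁ f) ∘ λ⇐

record TargetContextCategory (o ℓ e : Level) : Set (suc (o ⊔ ℓ ⊔ e)) where
  field
    gs : GSMonoidalCategory o ℓ
  open GSMonoidalCategory gs public
  field
    normalized : ∀ {A X} (f : Hom A X) → Normalized f
    T C : Obj
    _≽_ : ∀ {A} → Hom A (T ⊗₀ C) → Hom A (T ⊗₀ C) → Set e
    ≽-isPreorder : ∀ {A} → IsPreorder _≡_ (_≽_ {A})
    dom-≽ : ∀ {A} {f g : Hom A (T ⊗₀ C)} → f ∘ dom g ≡ g → f ≽ g
    ≽-precomp : ∀ {A B} {f g : Hom A (T ⊗₀ C)} (h : Hom B A) →
      f ≽ g → (f ∘ h) ≽ (g ∘ h)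

-- Deleting the output of w ⊗ f leaves w ∘ del ∘ f, so dom (w ⊗ f) = w ⊗ dom f.
-- Scalars commute with postcomposition, hence f ∘ dom (w ⊗ f) = w ⊗ (f ∘ dom f),
-- which is w ⊗ f because f is normalized; the first axiom of ≽ then gives f ≽ w ⊗ f.
module Submission where

open import Level using (Level)
open import Relation.Binary.PropositionalEquality
open ≡-Reasoning
open import Defs

module SymmetricMonoidalProperties {o ℓ : Level} (𝒮 : SymmetricMonoidalCategory o ℓ) where
  open SymmetricMonoidalCategory 𝒮

  left-inverse≡right-inverse : ∀ {A B} {p : Hom A B} {x y : Hom B A} →
    x ∘ p ≡ id → p ∘ y ≡ id → x ≡ y
  left-inverse≡right-inverse {p = p} {x} {y} x∘p≡id p∘y≡id = begin
    x            ≡⟨ sym identityʳ ⟩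
    x ∘ id       ≡⟨ cong (x ∘_) (sym p∘y≡id) ⟩
    x ∘ p ∘ y    ≡⟨ sym assoc ⟩
    (x ∘ p) ∘ y  ≡⟨ cong (_∘ y) x∘p≡id ⟩
    id ∘ y       ≡⟨ identityˡ ⟩
    y            ∎

  λ⇐-natural : ∀ {A B} {h : Hom A B} → λ⇐ ∘ h ≡ (id ⊗₁ h) ∘ λ⇐
  λ⇐-natural {h = h} = begin
    λ⇐ ∘ h                        ≡⟨ cong (λ⇐ ∘_) (sym identityʳ) ⟩
    λ⇐ ∘ h ∘ id                   ≡⟨ cong (λ x → λ⇐ ∘ h ∘ x) (sym λ-isoʳ) ⟩
    λ⇐ ∘ h ∘ λ⇒ ∘ λ⇐              ≡⟨ cong (λ⇐ ∘_) (sym assoc) ⟩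
    λ⇐ ∘ (h ∘ λ⇒) ∘ λ⇐            ≡⟨ cong (λ x → λ⇐ ∘ x ∘ λ⇐) (sym λ-natural) ⟩
    λ⇐ ∘ (λ⇒ ∘ (id ⊗₁ h)) ∘ λ⇐    ≡⟨ cong (λ⇐ ∘_) assoc ⟩
    λ⇐ ∘ λ⇒ ∘ (id ⊗₁ h) ∘ λ⇐      ≡⟨ sym assoc ⟩
    (λ⇐ ∘ λ⇒) ∘ (id ⊗₁ h) ∘ λ⇐    ≡⟨ cong (_∘ (id ⊗₁ h) ∘ λ⇐) λ-isoˡ ⟩
    id ∘ (id ⊗₁ h) ∘ λ⇐           ≡⟨ identityˡ ⟩
    (id ⊗₁ h) ∘ λ⇐                ∎

module GSMonoidalProperties {o ℓ : Level} (𝒢 : GSMonoidalCategory o ℓ) where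
  open GSMonoidalCategory 𝒢
  open SymmetricMonoidalProperties smc

  ρ⇐-by-counit : ∀ {A} → ρ⇐ {A} ≡ (id ⊗₁ del) ∘ copy
  ρ⇐-by-counit = left-inverse≡right-inverse ρ-isoˡ counitʳ

  λ⇐-by-counit : ∀ {A} → λ⇐ {A} ≡ (del ⊗₁ id) ∘ copy
  λ⇐-by-counit = left-inverse≡right-inverse λ-isoˡ counitˡ

  ρ⇐≡σ∘λ⇐ : ∀ {A} → ρ⇐ {A} ≡ σ ∘ λ⇐
  ρ⇐≡σ∘λ⇐ = begin
    ρ⇐                          ≡⟨ ρ⇐-by-counit ⟩
    (id ⊗₁ del) ∘ copy          ≡⟨ cong ((id ⊗₁ del) ∘_) (sym cocomm) ⟩
    (id ⊗₁ del) ∘ σ ∘ copy      ≡⟨ sym assoc ⟩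
    ((id ⊗₁ del) ∘ σ) ∘ copy    ≡⟨ cong (_∘ copy) (sym σ-natural) ⟩
    (σ ∘ (del ⊗₁ id)) ∘ copy    ≡⟨ assoc ⟩
    σ ∘ (del ⊗₁ id) ∘ copy      ≡⟨ cong (σ ∘_) (sym λ⇐-by-counit) ⟩
    σ ∘ λ⇐                      ∎

  ρ⇒∘σ≡λ⇒ : ∀ {A} → ρ⇒ {A} ∘ σ ≡ λ⇒
  ρ⇒∘σ≡λ⇒ = left-inverse≡right-inverse
    (trans assoc (trans (cong (ρ⇒ ∘_) (sym ρ⇐≡σ∘λ⇐)) ρ-isoʳ))
    λ-isoˡ

  -- In a bare monoidal category this is a consequence of coherence; here
  -- copy_I = λ⇐ and del_I = id give it directly.
  ρ⇒≡λ⇒-unit : ρ⇒ {unit} ≡ λ⇒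
  ρ⇒≡λ⇒-unit = left-inverse≡right-inverse
    (trans (cong (ρ⇒ ∘_) (sym ρ⇐≡λ⇐)) ρ-isoʳ)
    λ-isoˡ
    where
    ρ⇐≡λ⇐ : ρ⇐ {unit} ≡ λ⇐
    ρ⇐≡λ⇐ = begin
      ρ⇐                  ≡⟨ ρ⇐-by-counit ⟩
      (id ⊗₁ del) ∘ copy  ≡⟨ cong₂ (λ d c → (id ⊗₁ d) ∘ c) del-unit copy-unit ⟩
      (id ⊗₁ id) ∘ λ⇐     ≡⟨ cong (_∘ λ⇐) ⊗-identity ⟩
      id ∘ λ⇐             ≡⟨ identityˡ ⟩
      λ⇐                  ∎

  scaleʳ : ∀ {A X} → Hom unit unit → Hom A X → Hom A X
  scaleʳ w f = ρ⇒ ∘ (f ⊗₁ w) ∘ ρ⇐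

  scaleʳ≡scale : ∀ {A X} (w : Hom unit unit) (f : Hom A X) → scaleʳ w f ≡ scale w f
  scaleʳ≡scale w f = begin
    ρ⇒ ∘ (f ⊗₁ w) ∘ ρ⇐          ≡⟨ cong (λ x → ρ⇒ ∘ (f ⊗₁ w) ∘ x) ρ⇐≡σ∘λ⇐ ⟩
    ρ⇒ ∘ (f ⊗₁ w) ∘ σ ∘ λ⇐      ≡⟨ cong (ρ⇒ ∘_) (sym assoc) ⟩
    ρ⇒ ∘ ((f ⊗₁ w) ∘ σ) ∘ λ⇐    ≡⟨ cong (λ x → ρ⇒ ∘ x ∘ λ⇐) (sym σ-natural) ⟩
    ρ⇒ ∘ (σ ∘ (w ⊗₁ f)) ∘ λ⇐    ≡⟨ cong (ρ⇒ ∘_) assoc ⟩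
    ρ⇒ ∘ σ ∘ (w ⊗₁ f) ∘ λ⇐      ≡⟨ sym assoc ⟩
    (ρ⇒ ∘ σ) ∘ (w ⊗₁ f) ∘ λ⇐    ≡⟨ cong (_∘ (w ⊗₁ f) ∘ λ⇐) ρ⇒∘σ≡λ⇒ ⟩
    λ⇒ ∘ (w ⊗₁ f) ∘ λ⇐          ∎

  scale-∘ˡ : ∀ {A X Y} (w : Hom unit unit) (h : Hom X Y) (f : Hom A X) →
    h ∘ scale w f ≡ scale w (h ∘ f)
  scale-∘ˡ w h f = begin
    h ∘ λ⇒ ∘ (w ⊗₁ f) ∘ λ⇐                ≡⟨ sym assoc ⟩
    (h ∘ λ⇒) ∘ (w ⊗₁ f) ∘ λ⇐              ≡⟨ cong (_∘ (w ⊗₁ f) ∘ λ⇐) (sym λ-natural) ⟩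
    (λ⇒ ∘ (id ⊗₁ h)) ∘ (w ⊗₁ f) ∘ λ⇐      ≡⟨ assoc ⟩
    λ⇒ ∘ (id ⊗₁ h) ∘ (w ⊗₁ f) ∘ λ⇐        ≡⟨ cong (λ⇒ ∘_) (sym assoc) ⟩
    λ⇒ ∘ ((id ⊗₁ h) ∘ (w ⊗₁ f)) ∘ λ⇐      ≡⟨ cong (λ x → λ⇒ ∘ x ∘ λ⇐) (sym ⊗-homomorphism) ⟩
    λ⇒ ∘ ((id ∘ w) ⊗₁ (h ∘ f)) ∘ λ⇐       ≡⟨ cong (λ x → λ⇒ ∘ (x ⊗₁ (h ∘ f)) ∘ λ⇐) identityˡ ⟩
    λ⇒ ∘ (w ⊗₁ (h ∘ f)) ∘ λ⇐              ∎

  scale-∘ʳ : ∀ {A B X} (w : Hom unit unit) (f : Hom A X) (h : Hom B A) →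
    scale w f ∘ h ≡ scale w (f ∘ h)
  scale-∘ʳ w f h = begin
    (λ⇒ ∘ (w ⊗₁ f) ∘ λ⇐) ∘ h              ≡⟨ assoc ⟩
    λ⇒ ∘ ((w ⊗₁ f) ∘ λ⇐) ∘ h              ≡⟨ cong (λ⇒ ∘_) assoc ⟩
    λ⇒ ∘ (w ⊗₁ f) ∘ λ⇐ ∘ h                ≡⟨ cong (λ x → λ⇒ ∘ (w ⊗₁ f) ∘ x) λ⇐-natural ⟩
    λ⇒ ∘ (w ⊗₁ f) ∘ (id ⊗₁ h) ∘ λ⇐        ≡⟨ cong (λ⇒ ∘_) (sym assoc) ⟩
    λ⇒ ∘ ((w ⊗₁ f) ∘ (id ⊗₁ h)) ∘ λ⇐      ≡⟨ cong (λ x → λ⇒ ∘ x ∘ λ⇐) (sym ⊗-homomorphism) ⟩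
    λ⇒ ∘ ((w ∘ id) ⊗₁ (f ∘ h)) ∘ λ⇐       ≡⟨ cong (λ x → λ⇒ ∘ (x ⊗₁ (f ∘ h)) ∘ λ⇐) identityʳ ⟩
    λ⇒ ∘ (w ⊗₁ (f ∘ h)) ∘ λ⇐              ∎

  scale-id-unit : (w : Hom unit unit) → scale w (id {unit}) ≡ w
  scale-id-unit w = begin
    λ⇒ ∘ (w ⊗₁ id) ∘ λ⇐      ≡⟨ cong (_∘ (w ⊗₁ id) ∘ λ⇐) (sym ρ⇒≡λ⇒-unit) ⟩
    ρ⇒ ∘ (w ⊗₁ id) ∘ λ⇐      ≡⟨ sym assoc ⟩
    (ρ⇒ ∘ (w ⊗₁ id)) ∘ λ⇐    ≡⟨ cong (_∘ λ⇐) ρ-natural ⟩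
    (w ∘ ρ⇒) ∘ λ⇐            ≡⟨ assoc ⟩
    w ∘ ρ⇒ ∘ λ⇐              ≡⟨ cong (λ x → w ∘ x ∘ λ⇐) ρ⇒≡λ⇒-unit ⟩
    w ∘ λ⇒ ∘ λ⇐              ≡⟨ cong (w ∘_) λ-isoʳ ⟩
    w ∘ id                   ≡⟨ identityʳ ⟩
    w                        ∎

  del-scale : ∀ {A X} (w : Hom unit unit) (f : Hom A X) →
    del ∘ scale w f ≡ w ∘ del ∘ f
  del-scale w f = begin
    del ∘ scale w f            ≡⟨ scale-∘ˡ w del f ⟩
    scale w (del ∘ f)          ≡⟨ cong (scale w) (sym identityˡ) ⟩
    scale w (id ∘ del ∘ f)     ≡⟨ sym (scale-∘ʳ w id (del ∘ f)) ⟩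
    scale w id ∘ del ∘ f       ≡⟨ cong (_∘ del ∘ f) (scale-id-unit w) ⟩
    w ∘ del ∘ f                ∎

  dom-scale : ∀ {A X} (w : Hom unit unit) (f : Hom A X) →
    dom (scale w f) ≡ scale w (dom f)
  dom-scale w f = begin
    ρ⇒ ∘ (id ⊗₁ (del ∘ scale w f)) ∘ copy     ≡⟨ cong (λ x → ρ⇒ ∘ (id ⊗₁ x) ∘ copy) (del-scale w f) ⟩
    ρ⇒ ∘ (id ⊗₁ (w ∘ del ∘ f)) ∘ copy         ≡⟨ cong (λ x → ρ⇒ ∘ (x ⊗₁ (w ∘ del ∘ f)) ∘ copy) (sym identityˡ) ⟩
    ρ⇒ ∘ ((id ∘ id) ⊗₁ (w ∘ del ∘ f)) ∘ copy  ≡⟨ cong (λ x → ρ⇒ ∘ x ∘ copy) ⊗-homomorphism ⟩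
    ρ⇒ ∘ ((id ⊗₁ w) ∘ (id ⊗₁ (del ∘ f))) ∘ copy
                                              ≡⟨ cong (ρ⇒ ∘_) assoc ⟩
    ρ⇒ ∘ (id ⊗₁ w) ∘ (id ⊗₁ (del ∘ f)) ∘ copy ≡⟨ cong (λ x → ρ⇒ ∘ (id ⊗₁ w) ∘ x) (sym ρ⇐∘dom) ⟩
    ρ⇒ ∘ (id ⊗₁ w) ∘ ρ⇐ ∘ dom f               ≡⟨ cong (ρ⇒ ∘_) (sym assoc) ⟩
    ρ⇒ ∘ ((id ⊗₁ w) ∘ ρ⇐) ∘ dom f             ≡⟨ sym assoc ⟩
    scaleʳ w id ∘ dom f                       ≡⟨ cong (_∘ dom f) (scaleʳ≡scale w id) ⟩
    scale w id ∘ dom f                        ≡⟨ scale-∘ʳ w id (dom f) ⟩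
    scale w (id ∘ dom f)                      ≡⟨ cong (scale w) identityˡ ⟩
    scale w (dom f)                           ∎
    where
    ρ⇐∘dom : ρ⇐ ∘ dom f ≡ (id ⊗₁ (del ∘ f)) ∘ copy
    ρ⇐∘dom = trans (sym assoc) (trans (cong (_∘ (id ⊗₁ (del ∘ f)) ∘ copy) ρ-isoˡ) identityˡ)

mainTheorem13 : ∀ {o ℓ e : Level} (𝒞 : TargetContextCategory o ℓ e) →
    let open TargetContextCategory 𝒞 in
    ∀ {A : Obj} (w : Hom unit unit) (f : Hom A (T ⊗₀ C)) → f ≽ scale w f
mainTheorem13 𝒞 w f = dom-≽ (begin
    f ∘ dom (scale w f)   ≡⟨ cong (f ∘_) (dom-scale w f) ⟩
    f ∘ scale w (dom f)   ≡⟨ scale-∘ˡ w f (dom f) ⟩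
    scale w (f ∘ dom f)   ≡⟨ cong (scale w) (normalized f) ⟩
    scale w f             ∎)
  where
  open TargetContextCategory 𝒞
  open GSMonoidalProperties gs
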